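{- Let $P$ be a unification problem. If $P \Rightarrow^{+} P'$ (one or more transformation steps) with $P' = \langle \varnothing, \sigma_{P'}\rangle$ in solved form, then $\sigma_{P'}$ is a unifier of $P$.
   Context: Expressions: built from integer constants, string constants, the constant $\mathtt{empty}$, variables of the disjoint types $\mathtt{int},\mathtt{string},\mathtt{atom},\mathtt{list}$, and list concatenation $\mathtt{:}$. Types: $\mathtt{int},\mathtt{string} < \mathtt{atom} < \mathtt{list}$, with $\mathtt{int}$ and $\mathtt{string}$ incomparable. After normalisation, each expression has a smallest type: integer constants/variables have type $\mathtt{int}$, string constants/variables type $\mathtt{string}$, atom variables type $\mathtt{atom}$, and $\mathtt{empty}$, list variables and concatenations of at least two items type $\mathtt{list}$. A simple expression uses no operator other than $\mathtt{:}$ and contains at most one occurrence of a list variable. Normalisation: apply $L\mathtt{:}\mathtt{empty} \to L$, $\mathtt{empty}\mathtt{:}L \to L$ exhaustively. A substitution maps variables to expressions of their type; $t\theta$ is simultaneous replacement; $\sigma\circ\theta$ is defined by $x(\sigma\circ\theta) = (x\sigma)\theta$ if $x \in \mathrm{Dom}(\sigma)=\{x \mid x\sigma\neq x\}$ and $x\theta$ otherwise. $=_{\mathrm{AU}}$ is the congruence generated by $x\mathtt{:}(y\mathtt{:}z) = (x\mathtt{:}y)\mathtt{:}z$, $\mathtt{empty}\mathtt{:}x = x$, $x\mathtt{:}\mathtt{empty} = x$. A unification problem is either $\langle s = t, \sigma_P\rangle$ with $s,t$ simple list expressions without common variables, or a solved problem $\langle \varnothing, \sigma_P\rangle$, or $\mathtt{fail}$.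 A unifier of $\langle s=t,\sigma_P\rangle$ is a substitution $\theta$ with $s\theta =_{\mathrm{AU}} t\theta$ and $x_i\theta =_{\mathrm{AU}} t_i\theta$ for every binding $x_i\mapsto t_i$ of $\sigma_P$; a unifier of $\langle\varnothing,\sigma_P\rangle$ only needs the latter condition (so $\sigma_P$ unifies $\langle\varnothing,\sigma_P\rangle$ by definition). Transformation relation $\Rightarrow$: in the rules below, $L,M$ range over simple expressions (possibly $\mathtt{empty}$), $\mathtt{x},\mathtt{y}$ over variables of any type, $\mathtt{a},\mathtt{b}$ over integer/string constants or variables of type $\mathtt{int},\mathtt{string},\mathtt{atom}$, and $\mathtt{s}$ over integer/string constants or variables of any type. A rule applies to $P$ if its premise, after instantiation and normalisation, is identical to $P$ and its side conditions hold; the result is the normalised conclusion. Fresh variables are new list variables. Remove: $\langle L=L,\sigma\rangle \Rightarrow \langle\varnothing,\sigma\rangle$. Decomp1: $\langle \mathtt{x}\mathtt{:}L = \mathtt{s}\mathtt{:}M,\sigma\rangle \Rightarrow \langle L=M, \sigma\circ\{\mathtt{x}\mapsto\mathtt{s}\}\rangle$ if $L\neq\mathtt{empty}$, $\mathrm{type}(\mathtt{x})=\mathtt{list}$. Decomp1': $\langle \mathtt{x}\mathtt{:}L = \mathtt{a}\mathtt{:}M,\sigma\rangle \Rightarrow \langle (L=M)\{\mathtt{x}\mapsto\mathtt{a}\}, \sigma\circ\{\mathtt{x}\mapsto\mathtt{a}\}\rangle$ if $L\neq\mathtt{empty}$, $\mathrm{type}(\mathtt{a})\le\mathrm{type}(\mathtt{x})\le\mathtt{atom}$.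 Decomp2: $\langle \mathtt{x}\mathtt{:}L = \mathtt{y}\mathtt{:}M,\sigma\rangle \Rightarrow \langle \mathtt{x'}\mathtt{:}L = M, \sigma\circ\{\mathtt{x}\mapsto\mathtt{y}\mathtt{:}\mathtt{x'}\}\rangle$ if $L\neq\mathtt{empty}$, $\mathtt{x},\mathtt{y}$ of type $\mathtt{list}$, $\mathtt{x'}$ fresh. Decomp2': $\langle \mathtt{x}\mathtt{:}L = \mathtt{y}\mathtt{:}M,\sigma\rangle \Rightarrow \langle L = \mathtt{y'}\mathtt{:}M, \sigma\circ\{\mathtt{y}\mapsto\mathtt{x}\mathtt{:}\mathtt{y'}\}\rangle$ if $L\neq\mathtt{empty}$, $\mathtt{x},\mathtt{y}$ of type $\mathtt{list}$, $\mathtt{y'}$ fresh. Decomp3: $\langle \mathtt{s}\mathtt{:}L = \mathtt{s}\mathtt{:}M,\sigma\rangle \Rightarrow \langle L=M,\sigma\rangle$. Decomp4: $\langle \mathtt{x} = \mathtt{a}\mathtt{:}\mathtt{y},\sigma\rangle \Rightarrow \langle \mathtt{empty}=\mathtt{y}, \sigma\circ\{\mathtt{x}\mapsto\mathtt{a}\}\rangle$ if $\mathrm{type}(\mathtt{x})=\mathtt{atom}$, $\mathrm{type}(\mathtt{y})=\mathtt{list}$. Subst1: $\langle \mathtt{x} = L,\sigma\rangle \Rightarrow \langle\varnothing, \sigma\circ\{\mathtt{x}\mapsto L\}\rangle$ if $\mathtt{x}\notin\mathrm{Var}(L)$, $\mathrm{type}(\mathtt{x})\ge\mathrm{type}(L)$.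 Subst2: $\langle \mathtt{x}\mathtt{:}L = M,\sigma\rangle \Rightarrow \langle L=M, \sigma\circ\{\mathtt{x}\mapsto\mathtt{empty}\}\rangle$ if $L\neq\mathtt{empty}$, $\mathrm{type}(\mathtt{x})=\mathtt{list}$. Subst3: $\langle \mathtt{x}\mathtt{:}L = \mathtt{a}\mathtt{:}M,\sigma\rangle \Rightarrow \langle \mathtt{x'}\mathtt{:}L=M, \sigma\circ\{\mathtt{x}\mapsto\mathtt{a}\mathtt{:}\mathtt{x'}\}\rangle$ if $L\neq\mathtt{empty}$, $\mathtt{x'}$ fresh, $\mathrm{type}(\mathtt{x})=\mathtt{list}$. Orient1: $\langle \mathtt{a}\mathtt{:}M = \mathtt{x}\mathtt{:}L,\sigma\rangle \Rightarrow \langle \mathtt{x}\mathtt{:}L = \mathtt{a}\mathtt{:}M,\sigma\rangle$ if $\mathtt{a}$ is not a variable. Orient2: $\langle \mathtt{x}\mathtt{:}L = \mathtt{y},\sigma\rangle \Rightarrow \langle \mathtt{y} = \mathtt{x}\mathtt{:}L,\sigma\rangle$ if $L\neq\mathtt{empty}$, $\mathrm{type}(\mathtt{x})=\mathrm{type}(\mathtt{y})$. Orient3: $\langle \mathtt{y}\mathtt{:}M = \mathtt{x}\mathtt{:}L,\sigma\rangle \Rightarrow \langle \mathtt{x}\mathtt{:}L = \mathtt{y}\mathtt{:}M,\sigma\rangle$ if $\mathrm{type}(\mathtt{y})<\mathrm{type}(\mathtt{x})$. Orient4: $\langle \mathtt{empty} = \mathtt{x}\mathtt{:}L,\sigma\rangle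 \Rightarrow \langle \mathtt{x}\mathtt{:}L = \mathtt{empty},\sigma\rangle$ if $\mathrm{type}(\mathtt{x})=\mathtt{list}$.
   Formalization: $\sigma_P$ is assumed idempotent (no variable of $\mathrm{Dom}(\sigma_P)$ occurs in any $x\sigma_P$), and when $P = \langle s = t, \sigma_P\rangle$ no variable of $s$ or $t$ lies in $\mathrm{Dom}(\sigma_P)$. The statement above fails without it. -}

module Defs where

open import Data.Nat using (ℕ; zero; suc; _+_) renaming (_≤_ to _≤ℕ_)
import Data.Nat as ℕ
open import Data.Integer using (ℤ)
import Data.Integer as ℤ
open import Data.String using (String)
import Data.String as Str
open import Data.List using (List; []; _∷_; _++_)
open import Data.List.Membership.Propositional using (_∈_)
open import Data.Product using (_×_; _,_; Σ; ∃)
open import Data.Empty using (⊥)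
open import Data.Unit using (⊤)
open import Relation.Nullary using (¬_; Dec; yes; no)
open import Relation.Binary.PropositionalEquality using (_≡_; refl; cong; cong₂; _≢_)

data Ty : Set where
  int string atom list : Ty

data _≤T_ : Ty → Ty → Set where
  ≤T-refl       : ∀ {τ} → τ ≤T τ
  int≤atom      : int ≤T atom
  string≤atom   : string ≤T atom
  int≤list      : int ≤T list
  string≤list   : string ≤T list
  atom≤list     : atom ≤T list

_<T_ : Ty → Ty → Set
τ <T υ = (τ ≤T υ) × (τ ≢ υ)

_≟T_ : (τ υ : Ty) → Dec (τ ≡ υ)
int    ≟T int    = yes refl
int    ≟T string = no λ ()
int    ≟T atom   = no λ ()
int    ≟T list   = no λ ()
string ≟T int    = no λ ()
string ≟T string = yes refl
string ≟T atom   = no λ ()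
string ≟T list   = no λ ()
atom   ≟T int    = no λ ()
atom   ≟T string = no λ ()
atom   ≟T atom   = yes refl
atom   ≟T list   = no λ ()
list   ≟T int    = no λ ()
list   ≟T string = no λ ()
list   ≟T atom   = no λ ()
list   ≟T list   = yes refl

-- Variables: a name together with its (fixed) type; the types are
-- disjoint since the type is part of the variable.

record Var : Set where
  constructor mkVar
  field
    name : ℕ
    ty   : Ty
open Var public

_≟V_ : (x y : Var) → Dec (x ≡ y)
mkVar n τ ≟V mkVar m υ with n ℕ.≟ m | τ ≟T υ
... | yes refl | yes refl = yes refl
... | no n≢m   | _        = no λ { refl → n≢m refl }
... | yes _    | no τ≢υ   = no λ { refl → τ≢υ refl }

infixr 5 _⸴_

data Expr : Set where
  icon  : ℤ → Expr
  scon  : String → Expr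
  empty : Expr
  var   : Var → Expr
  _⸴_   : Expr → Expr → Expr  -- list concatenation  L : M

_≟E_ : (e f : Expr) → Dec (e ≡ f)
icon i ≟E icon j with i ℤ.≟ j
... | yes refl = yes refl
... | no ne = no λ { refl → ne refl }
icon _ ≟E scon _ = no λ ()
icon _ ≟E empty = no λ ()
icon _ ≟E var _ = no λ ()
icon _ ≟E (_ ⸴ _) = no λ ()
scon _ ≟E icon _ = no λ ()
scon s ≟E scon t with s Str.≟ t
... | yes refl = yes refl
... | no ne = no λ { refl → ne refl }
scon _ ≟E empty = no λ ()
scon _ ≟E var _ = no λ ()
scon _ ≟E (_ ⸴ _) = no λ ()
empty ≟E icon _ = no λ ()
empty ≟E scon _ = no λ ()
empty ≟E empty = yes refl
empty ≟E var _ = no λ ()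
empty ≟E (_ ⸴ _) = no λ ()
var _ ≟E icon _ = no λ ()
var _ ≟E scon _ = no λ ()
var _ ≟E empty = no λ ()
var x ≟E var y with x ≟V y
... | yes refl = yes refl
... | no ne = no λ { refl → ne refl }
var _ ≟E (_ ⸴ _) = no λ ()
(_ ⸴ _) ≟E icon _ = no λ ()
(_ ⸴ _) ≟E scon _ = no λ ()
(_ ⸴ _) ≟E empty = no λ ()
(_ ⸴ _) ≟E var _ = no λ ()
(a ⸴ b) ≟E (c ⸴ d) with a ≟E c | b ≟E d
... | yes refl | yes refl = yes refl
... | no ne | _ = no λ { refl → ne refl }
... | yes _ | no ne = no λ { refl → ne refl }

vars : Expr → List Var
vars (icon _) = []
vars (scon _) = []
vars empty    = []
vars (var x)  = x ∷ []
vars (a ⸴ b)  = vars a ++ vars b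

-- Normalisation: exhaustive application of  L:empty → L,  empty:L → L.
-- (The rewrite system is terminating and confluent; `norm` computes the
-- unique normal form bottom-up.)

norm : Expr → Expr
norm (a ⸴ b) with norm a | norm b
... | empty | b' = b'
... | a'    | empty = a'
... | a'    | b' = a' ⸴ b'
norm e = e

-- smallest type of a normalised expression
typeN : Expr → Ty
typeN (icon _) = int
typeN (scon _) = string
typeN empty    = list
typeN (var x)  = ty x
typeN (_ ⸴ _)  = list

type : Expr → Ty
type e = typeN (norm e)

-- Simple expressions: at most one occurrence of a list variable
-- (the only operator available is `:` anyway).

listVarOcc : Expr → ℕ
listVarOcc (var x) with ty x
... | list = 1
... | _    = 0
listVarOcc (a ⸴ b) = listVarOcc a + listVarOcc b
listVarOcc _ = 0

Simple : Expr → Set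
Simple e = listVarOcc e ≤ℕ 1

data IsA : Expr → Set where
  a-int : ∀ i → IsA (icon i)
  a-str : ∀ s → IsA (scon s)
  a-var : ∀ x → ty x ≢ list → IsA (var x)

data IsS : Expr → Set where
  s-int : ∀ i → IsS (icon i)
  s-str : ∀ s → IsS (scon s)
  s-var : ∀ x → IsS (var x)

Subst : Set
Subst = Var → Expr

IsSubst : Subst → Set
IsSubst σ = ∀ x → type (σ x) ≤T ty x

idS : Subst
idS = var

_[_] : Expr → Subst → Expr
icon i  [ θ ] = icon i
scon s  [ θ ] = scon s
empty   [ θ ] = empty
var x   [ θ ] = θ x
(a ⸴ b) [ θ ] = (a [ θ ]) ⸴ (b [ θ ])

_∈Dom_ : Var → Subst → Set
x ∈Dom σ = σ x ≢ var x

⟦_↦_⟧ : Var → Expr → Subst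
⟦ x ↦ t ⟧ y with y ≟V x
... | yes _ = t
... | no  _ = var y

_∘ₛ_ : Subst → Subst → Subst
(σ ∘ₛ θ) x with σ x ≟E var x
... | yes _ = θ x
... | no  _ = σ x [ θ ]

infix 4 _≈AU_
data _≈AU_ : Expr → Expr → Set where
  au-refl  : ∀ {e} → e ≈AU e
  au-sym   : ∀ {e f} → e ≈AU f → f ≈AU e
  au-trans : ∀ {e f g} → e ≈AU f → f ≈AU g → e ≈AU g
  au-cong  : ∀ {a b c d} → a ≈AU c → b ≈AU d → (a ⸴ b) ≈AU (c ⸴ d)
  au-assoc : ∀ x y z → (x ⸴ (y ⸴ z)) ≈AU ((x ⸴ y) ⸴ z)
  au-unitˡ : ∀ x → (empty ⸴ x) ≈AU x
  au-unitʳ : ∀ x → (x ⸴ empty) ≈AU x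

data Problem : Set where
  ⟨_≐_,_⟩ : Expr → Expr → Subst → Problem
  ⟨∅,_⟩   : Subst → Problem
  fail    : Problem

NoCommonVars : Expr → Expr → Set
NoCommonVars s t = ∀ x → x ∈ vars s → x ∈ vars t → ⊥

IsUnifProblem : Problem → Set
IsUnifProblem ⟨ s ≐ t , σ ⟩ = Simple s × Simple t × NoCommonVars s t × IsSubst σ
IsUnifProblem ⟨∅, σ ⟩ = IsSubst σ
IsUnifProblem fail = ⊥

UnifiesBindings : Subst → Subst → Set
UnifiesBindings θ σ = ∀ x → x ∈Dom σ → θ x ≈AU (σ x [ θ ])

IsUnifier : Subst → Problem → Set
IsUnifier θ ⟨ s ≐ t , σ ⟩ = IsSubst θ × (s [ θ ]) ≈AU (t [ θ ]) × UnifiesBindings θ σ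
IsUnifier θ ⟨∅, σ ⟩ = IsSubst θ × UnifiesBindings θ σ
IsUnifier θ fail = ⊥

Fresh : Var → Expr → Expr → Subst → Set
Fresh x' s t σ =
  (ty x' ≡ list) × ¬ (x' ∈ vars s) × ¬ (x' ∈ vars t) × ¬ (x' ∈Dom σ) ×
  (∀ y → y ∈Dom σ → ¬ (x' ∈ vars (σ y)))

-- A rule applies to P = ⟨ s ≐ t , σ ⟩
-- if its premise, after instantiation and normalisation, is identical to
-- P (s ≡ norm lhs, t ≡ norm rhs) and the side conditions hold; the
-- result is the normalised conclusion.  L, M range over simple
-- expressions, x, y over variables, a over IsA, s over IsS.

infix 3 _⇒_
data _⇒_ : Problem → Problem → Set where

  Remove : ∀ {s t σ} L → Simple L →
    s ≡ norm L → t ≡ norm L →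
    ⟨ s ≐ t , σ ⟩ ⇒ ⟨∅, σ ⟩

  Decomp1 : ∀ {s t σ} x L e M → Simple L → Simple M → IsS e →
    s ≡ norm (var x ⸴ L) → t ≡ norm (e ⸴ M) →
    norm L ≢ empty → ty x ≡ list →
    ⟨ s ≐ t , σ ⟩ ⇒ ⟨ norm L ≐ norm M , σ ∘ₛ ⟦ x ↦ e ⟧ ⟩

  Decomp1' : ∀ {s t σ} x L a M → Simple L → Simple M → IsA a →
    s ≡ norm (var x ⸴ L) → t ≡ norm (a ⸴ M) →
    norm L ≢ empty → type a ≤T ty x → ty x ≤T atom →
    ⟨ s ≐ t , σ ⟩ ⇒
      ⟨ norm (L [ ⟦ x ↦ a ⟧ ]) ≐ norm (M [ ⟦ x ↦ a ⟧ ]) , σ ∘ₛ ⟦ x ↦ a ⟧ ⟩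

  Decomp2 : ∀ {s t σ} x L y M x' → Simple L → Simple M →
    s ≡ norm (var x ⸴ L) → t ≡ norm (var y ⸴ M) →
    norm L ≢ empty → ty x ≡ list → ty y ≡ list → Fresh x' s t σ →
    ⟨ s ≐ t , σ ⟩ ⇒ ⟨ norm (var x' ⸴ L) ≐ norm M , σ ∘ₛ ⟦ x ↦ var y ⸴ var x' ⟧ ⟩

  Decomp2' : ∀ {s t σ} x L y M y' → Simple L → Simple M →
    s ≡ norm (var x ⸴ L) → t ≡ norm (var y ⸴ M) →
    norm L ≢ empty → ty x ≡ list → ty y ≡ list → Fresh y' s t σ →
    ⟨ s ≐ t , σ ⟩ ⇒ ⟨ norm L ≐ norm (var y' ⸴ M) , σ ∘ₛ ⟦ y ↦ var x ⸴ var y' ⟧ ⟩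

  Decomp3 : ∀ {s t σ} e L M → Simple L → Simple M → IsS e →
    s ≡ norm (e ⸴ L) → t ≡ norm (e ⸴ M) →
    ⟨ s ≐ t , σ ⟩ ⇒ ⟨ norm L ≐ norm M , σ ⟩

  Decomp4 : ∀ {s t σ} x a y → IsA a →
    s ≡ var x → t ≡ norm (a ⸴ var y) →
    ty x ≡ atom → ty y ≡ list →
    ⟨ s ≐ t , σ ⟩ ⇒ ⟨ empty ≐ var y , σ ∘ₛ ⟦ x ↦ a ⟧ ⟩

  Subst1 : ∀ {s t σ} x L → Simple L →
    s ≡ var x → t ≡ norm L →
    ¬ (x ∈ vars L) → type L ≤T ty x →
    ⟨ s ≐ t , σ ⟩ ⇒ ⟨∅, σ ∘ₛ ⟦ x ↦ L ⟧ ⟩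

  Subst2 : ∀ {s t σ} x L M → Simple L → Simple M →
    s ≡ norm (var x ⸴ L) → t ≡ norm M →
    norm L ≢ empty → ty x ≡ list →
    ⟨ s ≐ t , σ ⟩ ⇒ ⟨ norm L ≐ norm M , σ ∘ₛ ⟦ x ↦ empty ⟧ ⟩

  Subst3 : ∀ {s t σ} x L a M x' → Simple L → Simple M → IsA a →
    s ≡ norm (var x ⸴ L) → t ≡ norm (a ⸴ M) →
    norm L ≢ empty → ty x ≡ list → Fresh x' s t σ →
    ⟨ s ≐ t , σ ⟩ ⇒ ⟨ norm (var x' ⸴ L) ≐ norm M , σ ∘ₛ ⟦ x ↦ a ⸴ var x' ⟧ ⟩

  Orient1 : ∀ {s t σ} a M x L → Simple M → Simple L → IsA a →
    (∀ v → a ≢ var v) →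
    s ≡ norm (a ⸴ M) → t ≡ norm (var x ⸴ L) →
    ⟨ s ≐ t , σ ⟩ ⇒ ⟨ norm (var x ⸴ L) ≐ norm (a ⸴ M) , σ ⟩

  Orient2 : ∀ {s t σ} x L y → Simple L →
    s ≡ norm (var x ⸴ L) → t ≡ var y →
    norm L ≢ empty → ty x ≡ ty y →
    ⟨ s ≐ t , σ ⟩ ⇒ ⟨ var y ≐ norm (var x ⸴ L) , σ ⟩

  Orient3 : ∀ {s t σ} y M x L → Simple M → Simple L →
    s ≡ norm (var y ⸴ M) → t ≡ norm (var x ⸴ L) →
    ty y <T ty x →
    ⟨ s ≐ t , σ ⟩ ⇒ ⟨ norm (var x ⸴ L) ≐ norm (var y ⸴ M) , σ ⟩

  Orient4 : ∀ {s t σ} x L → Simple L →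
    s ≡ empty → t ≡ norm (var x ⸴ L) →
    ty x ≡ list →
    ⟨ s ≐ t , σ ⟩ ⇒ ⟨ norm (var x ⸴ L) ≐ empty , σ ⟩

infix 3 _⇒⁺_
data _⇒⁺_ : Problem → Problem → Set where
  [_] : ∀ {P Q} → P ⇒ Q → P ⇒⁺ Q
  _∷_ : ∀ {P Q R} → P ⇒ Q → Q ⇒⁺ R → P ⇒⁺ R

-- Implicit invariants on the substitution component of a problem: the variables of the equation are not in
-- Dom(σ), and σ is idempotent (Dom(σ) contains no variable of the range).

DomAvoidsEquation : Problem → Set
DomAvoidsEquation ⟨ s ≐ t , σ ⟩ =
  (∀ x → x ∈ vars s → ¬ (x ∈Dom σ)) × (∀ x → x ∈ vars t → ¬ (x ∈Dom σ))
DomAvoidsEquation ⟨∅, σ ⟩ = ⊤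
DomAvoidsEquation fail = ⊤

Idempotent : Subst → Set
Idempotent σ = ∀ x y → x ∈Dom σ → y ∈ vars (σ x) → ¬ (y ∈Dom σ)

substOf : Problem → Subst
substOf ⟨ _ ≐ _ , σ ⟩ = σ
substOf ⟨∅, σ ⟩ = σ
substOf fail = idS

-- Every rule of ⇒ is a composite of five elementary moves on ⟨ s ≐ t , σ ⟩:
-- rewriting a side modulo AU (in particular normalising it), swapping the
-- sides, cancelling a common head, deleting an equation s = s, and
-- instantiating a variable x by e throughout while composing σ with {x ↦ e}.
-- Each move keeps σ an idempotent substitution fixing the variables of the
-- equation, and pulls solutions back; for instantiation this is because a
-- solution θ of the new problem has xθ =AU eθ, hence (f{x ↦ e})θ =AU fθ.
-- The moves need not keep the equation simple with disjoint list variables,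
-- but every rule as a whole does, and this is what ensures that a bound head
-- list variable occurs nowhere else, so that instantiating it leaves the
-- rest of the equation unchanged.  An idempotent solved σ' then satisfies
-- its own bindings, since (xσ')σ' = xσ'.

module Submission where

open import Algebra.Bundles using (Monoid)
open import Data.Empty using (⊥; ⊥-elim)
open import Data.List.Membership.Propositional using (_∈_; _∉_)
open import Data.List.Membership.Propositional.Properties using (∈-++⁺ˡ; ∈-++⁺ʳ; ∈-++⁻)
open import Data.List.Properties using (++-monoid)
open import Data.List.Relation.Unary.Any using (here; there)
open import Data.Nat using (_+_; _≤_; z≤n; s≤s)
open import Data.Nat.Properties using (≤-trans; ≤-reflexive; +-mono-≤; +-0-monoid; m≤m+n; m≤n+m)
open import Data.Product using (_×_; _,_; uncurry)
open import Data.Sum using (inj₁; inj₂; [_,_]′)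
open import Data.Unit using (⊤; tt)
open import Function using (_∘_)
open import Relation.Binary.PropositionalEquality using (_≡_; _≢_; refl; sym; trans; cong; cong₂; subst)
open import Relation.Nullary using (¬_; yes; no)
open import Relation.Nullary.Decidable using (decidable-stable)

open import Defs renaming ([_] to [_]⁺)

-- Equality modulo AU and normal forms

≈AU-reflexive : ∀ {e f} → e ≡ f → e ≈AU f
≈AU-reflexive refl = au-refl

module _ {c ℓ} (M : Monoid c ℓ) (h : Expr → Monoid.Carrier M) where

  open Monoid M renaming (refl to ≈-refl; sym to ≈-sym; trans to ≈-trans)
  open import Relation.Binary.Reasoning.Setoid setoid

  homomorphism-resp-≈AU : h empty ≈ ε → (∀ a b → h (a ⸴ b) ≈ h a ∙ h b) →
                          ∀ {e f} → e ≈AU f → h e ≈ h f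
  homomorphism-resp-≈AU h-empty h-⸴ = resp
    where
    resp : ∀ {e f} → e ≈AU f → h e ≈ h f
    resp au-refl        = ≈-refl
    resp (au-sym p)     = ≈-sym (resp p)
    resp (au-trans p q) = ≈-trans (resp p) (resp q)
    resp (au-cong {a} {b} {c} {d} p q) = begin
      h (a ⸴ b)   ≈⟨ h-⸴ a b ⟩
      h a ∙ h b   ≈⟨ ∙-cong (resp p) (resp q) ⟩
      h c ∙ h d   ≈⟨ h-⸴ c d ⟨
      h (c ⸴ d)   ∎
    resp (au-assoc x y z) = begin
      h (x ⸴ (y ⸴ z))     ≈⟨ ≈-trans (h-⸴ x (y ⸴ z)) (∙-congˡ (h-⸴ y z)) ⟩
      h x ∙ (h y ∙ h z)   ≈⟨ assoc (h x) (h y) (h z) ⟨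
      (h x ∙ h y) ∙ h z   ≈⟨ ≈-trans (h-⸴ (x ⸴ y) z) (∙-congʳ (h-⸴ x y)) ⟨
      h ((x ⸴ y) ⸴ z)     ∎
    resp (au-unitˡ x) = begin
      h (empty ⸴ x)   ≈⟨ h-⸴ empty x ⟩
      h empty ∙ h x   ≈⟨ ∙-congʳ h-empty ⟩
      ε ∙ h x         ≈⟨ identityˡ (h x) ⟩
      h x             ∎
    resp (au-unitʳ x) = begin
      h (x ⸴ empty)   ≈⟨ h-⸴ x empty ⟩
      h x ∙ h empty   ≈⟨ ∙-congˡ h-empty ⟩
      h x ∙ ε         ≈⟨ identityʳ (h x) ⟩
      h x             ∎

vars-≈AU : ∀ {e f} → e ≈AU f → vars e ≡ vars f
vars-≈AU = homomorphism-resp-≈AU (++-monoid Var) vars refl (λ _ _ → refl)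

listVarOcc-≈AU : ∀ {e f} → e ≈AU f → listVarOcc e ≡ listVarOcc f
listVarOcc-≈AU = homomorphism-resp-≈AU +-0-monoid listVarOcc refl (λ _ _ → refl)

data Glued : Expr → Expr → Expr → Set where
  emptyˡ : ∀ {b} → Glued empty b b
  emptyʳ : ∀ {a} → a ≢ empty → Glued a empty a
  proper : ∀ {a b} → a ≢ empty → b ≢ empty → Glued a b (a ⸴ b)

norm-⸴ : ∀ a b → Glued (norm a) (norm b) (norm (a ⸴ b))
norm-⸴ a b with norm a | norm b
... | empty   | _       = emptyˡ
... | icon _  | empty   = emptyʳ λ ()
... | scon _  | empty   = emptyʳ λ ()
... | var _   | empty   = emptyʳ λ ()
... | _ ⸴ _   | empty   = emptyʳ λ ()
... | icon _  | icon _  = proper (λ ()) (λ ())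
... | icon _  | scon _  = proper (λ ()) (λ ())
... | icon _  | var _   = proper (λ ()) (λ ())
... | icon _  | _ ⸴ _   = proper (λ ()) (λ ())
... | scon _  | icon _  = proper (λ ()) (λ ())
... | scon _  | scon _  = proper (λ ()) (λ ())
... | scon _  | var _   = proper (λ ()) (λ ())
... | scon _  | _ ⸴ _   = proper (λ ()) (λ ())
... | var _   | icon _  = proper (λ ()) (λ ())
... | var _   | scon _  = proper (λ ()) (λ ())
... | var _   | var _   = proper (λ ()) (λ ())
... | var _   | _ ⸴ _   = proper (λ ()) (λ ())
... | _ ⸴ _   | icon _  = proper (λ ()) (λ ())
... | _ ⸴ _   | scon _  = proper (λ ()) (λ ())
... | _ ⸴ _   | var _   = proper (λ ()) (λ ())
... | _ ⸴ _   | _ ⸴ _   = proper (λ ()) (λ ())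

norm≈AU : ∀ e → norm e ≈AU e
norm≈AU (a ⸴ b) = glued (norm-⸴ a b) (norm≈AU a) (norm≈AU b)
  where
  glued : ∀ {a′ b′ r} → Glued a′ b′ r → a′ ≈AU a → b′ ≈AU b → r ≈AU a ⸴ b
  glued emptyˡ       p q = au-trans (au-sym (au-unitˡ _)) (au-cong p q)
  glued (emptyʳ _)   p q = au-trans (au-sym (au-unitʳ _)) (au-cong p q)
  glued (proper _ _) p q = au-cong p q
norm≈AU (icon _) = au-refl
norm≈AU (scon _) = au-refl
norm≈AU empty    = au-refl
norm≈AU (var _)  = au-refl

∉-norm : ∀ e {w} → w ∉ vars (norm e) → w ∉ vars e
∉-norm e w∉ = w∉ ∘ subst (_ ∈_) (sym (vars-≈AU (norm≈AU e)))

-- Types of substitution instances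

≤T-trans : ∀ {τ υ ν} → τ ≤T υ → υ ≤T ν → τ ≤T ν
≤T-trans ≤T-refl      q         = q
≤T-trans int≤atom     ≤T-refl   = int≤atom
≤T-trans int≤atom     atom≤list = int≤list
≤T-trans string≤atom  ≤T-refl   = string≤atom
≤T-trans string≤atom  atom≤list = string≤list
≤T-trans int≤list     ≤T-refl   = int≤list
≤T-trans string≤list  ≤T-refl   = string≤list
≤T-trans atom≤list    ≤T-refl   = atom≤list

≤T-list : ∀ {τ υ} → υ ≡ list → τ ≤T υ
≤T-list {int}    refl = int≤list
≤T-list {string} refl = string≤list
≤T-list {atom}   refl = atom≤list
≤T-list {list}   refl = ≤T-refl

norm-empty-[] : ∀ e θ → norm e ≡ empty → norm (e [ θ ]) ≡ empty
norm-empty-[] empty   θ _ = refl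
norm-empty-[] (a ⸴ b) θ =
  glued (norm-⸴ a b) (norm-⸴ (a [ θ ]) (b [ θ ])) (norm-empty-[] a θ) (norm-empty-[] b θ)
  where
  glued : ∀ {a′ b′ r a″ b″ r′} → Glued a′ b′ r → Glued a″ b″ r′ →
          (a′ ≡ empty → a″ ≡ empty) → (b′ ≡ empty → b″ ≡ empty) → r ≡ empty → r′ ≡ empty
  glued emptyˡ       emptyˡ         _       keep-b = keep-b
  glued emptyˡ       (emptyʳ a″≢)   keep-a  _ _    = ⊥-elim (a″≢ (keep-a refl))
  glued emptyˡ       (proper a″≢ _) keep-a  _ _    = ⊥-elim (a″≢ (keep-a refl))
  glued (emptyʳ a′≢) _              _       _ r≡   = ⊥-elim (a′≢ r≡)
  glued (proper _ _) _              _       _ ()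
norm-empty-[] (icon _) θ ()
norm-empty-[] (scon _) θ ()
norm-empty-[] (var _)  θ ()

type-[] : ∀ {θ} → IsSubst θ → ∀ e → type (e [ θ ]) ≤T type e
type-[] {θ} θ-ok (a ⸴ b) =
  glued (norm-⸴ a b) (norm-⸴ (a [ θ ]) (b [ θ ]))
        (norm-empty-[] a θ) (norm-empty-[] b θ) (type-[] θ-ok a) (type-[] θ-ok b)
  where
  glued : ∀ {a′ b′ r a″ b″ r′} → Glued a′ b′ r → Glued a″ b″ r′ →
          (a′ ≡ empty → a″ ≡ empty) → (b′ ≡ empty → b″ ≡ empty) →
          typeN a″ ≤T typeN a′ → typeN b″ ≤T typeN b′ → typeN r′ ≤T typeN r
  glued (proper _ _) _              _      _      _  _  = ≤T-list refl
  glued emptyˡ       emptyˡ         _      _      _  tb = tb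
  glued emptyˡ       (emptyʳ a″≢)   keep-a _      _  _  = ⊥-elim (a″≢ (keep-a refl))
  glued emptyˡ       (proper a″≢ _) keep-a _      _  _  = ⊥-elim (a″≢ (keep-a refl))
  glued (emptyʳ _)   emptyˡ         _      keep-b ta _  = subst (λ e → typeN e ≤T _) (sym (keep-b refl)) ta
  glued (emptyʳ _)   (emptyʳ _)     _      _      ta _  = ta
  glued (emptyʳ _)   (proper _ b″≢) _      keep-b _  _  = ⊥-elim (b″≢ (keep-b refl))
type-[] θ-ok (var x)  = θ-ok x
type-[] θ-ok (icon _) = ≤T-refl
type-[] θ-ok (scon _) = ≤T-refl
type-[] θ-ok empty    = ≤T-refl

-- Substitutions

[]-resp-≈AU : ∀ θ {e f} → e ≈AU f → e [ θ ] ≈AU f [ θ ]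
[]-resp-≈AU θ au-refl          = au-refl
[]-resp-≈AU θ (au-sym p)       = au-sym ([]-resp-≈AU θ p)
[]-resp-≈AU θ (au-trans p q)   = au-trans ([]-resp-≈AU θ p) ([]-resp-≈AU θ q)
[]-resp-≈AU θ (au-cong p q)    = au-cong ([]-resp-≈AU θ p) ([]-resp-≈AU θ q)
[]-resp-≈AU θ (au-assoc x y z) = au-assoc _ _ _
[]-resp-≈AU θ (au-unitˡ x)     = au-unitˡ _
[]-resp-≈AU θ (au-unitʳ x)     = au-unitʳ _

[]-[] : ∀ f ρ θ → (f [ ρ ]) [ θ ] ≡ f [ (λ z → ρ z [ θ ]) ]
[]-[] (icon _) ρ θ = refl
[]-[] (scon _) ρ θ = refl
[]-[] empty    ρ θ = refl
[]-[] (var _)  ρ θ = refl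
[]-[] (a ⸴ b)  ρ θ = cong₂ _⸴_ ([]-[] a ρ θ) ([]-[] b ρ θ)

[]-cong : ∀ f {θ θ′} → (∀ z → θ z ≈AU θ′ z) → f [ θ ] ≈AU f [ θ′ ]
[]-cong (icon _) θ≈θ′ = au-refl
[]-cong (scon _) θ≈θ′ = au-refl
[]-cong empty    θ≈θ′ = au-refl
[]-cong (var x)  θ≈θ′ = θ≈θ′ x
[]-cong (a ⸴ b)  θ≈θ′ = au-cong ([]-cong a θ≈θ′) ([]-cong b θ≈θ′)

Fixes : Subst → Expr → Set
Fixes σ e = ∀ {w} → w ∈ vars e → σ w ≡ var w

FixesRange : Subst → Set
FixesRange σ = ∀ z → Fixes σ (σ z)

[]-identity : ∀ f {θ} → Fixes θ f → f [ θ ] ≡ f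
[]-identity (icon _) θf = refl
[]-identity (scon _) θf = refl
[]-identity empty    θf = refl
[]-identity (var _)  θf = θf (here refl)
[]-identity (a ⸴ b)  θf =
  cong₂ _⸴_ ([]-identity a (θf ∘ ∈-++⁺ˡ)) ([]-identity b (θf ∘ ∈-++⁺ʳ (vars a)))

fixes-[] : ∀ f {σ θ} → (∀ {z} → z ∈ vars f → Fixes σ (θ z)) → Fixes σ (f [ θ ])
fixes-[] (var _) σθf = σθf (here refl)
fixes-[] (a ⸴ b) σθf w∈ with ∈-++⁻ (vars (a [ _ ])) w∈
... | inj₁ w∈a = fixes-[] a (σθf ∘ ∈-++⁺ˡ) w∈a
... | inj₂ w∈b = fixes-[] b (σθf ∘ ∈-++⁺ʳ (vars a)) w∈b

∉Dom⇒fixed : ∀ σ x → ¬ (x ∈Dom σ) → σ x ≡ var x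
∉Dom⇒fixed σ x = decidable-stable (σ x ≟E var x)

idempotent⇒fixesRange : ∀ {σ} → Idempotent σ → FixesRange σ
idempotent⇒fixesRange {σ} idem z {w} w∈ with σ z ≟E var z
... | yes σz≡z with subst (λ e → w ∈ vars e) σz≡z w∈
...   | here refl = σz≡z
idempotent⇒fixesRange {σ} idem z {w} w∈ | no z∈Dom = ∉Dom⇒fixed σ w (idem z w z∈Dom w∈)

↦-self : ∀ x e → ⟦ x ↦ e ⟧ x ≡ e
↦-self x e with x ≟V x
... | yes _   = refl
... | no x≢x = ⊥-elim (x≢x refl)

↦-other : ∀ {x w} e → w ≢ x → ⟦ x ↦ e ⟧ w ≡ var w
↦-other {x} {w} e w≢x with w ≟V x
... | yes w≡x = ⊥-elim (w≢x w≡x)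
... | no _    = refl

↦-fixes-∉ : ∀ {x e} f → x ∉ vars f → Fixes ⟦ x ↦ e ⟧ f
↦-fixes-∉ {e = e} f x∉f w∈ = ↦-other e λ { refl → x∉f w∈ }

↦-fixesRange : ∀ {x e} → Fixes ⟦ x ↦ e ⟧ e → FixesRange ⟦ x ↦ e ⟧
↦-fixesRange {x} {e} ρe z with z ≟V x
... | yes _   = ρe
... | no z≢x = λ { (here refl) → ↦-other e z≢x }

fixes-[↦] : ∀ {σ x e} f → Fixes σ f → Fixes σ e → Fixes σ (f [ ⟦ x ↦ e ⟧ ])
fixes-[↦] {σ} {x} {e} f σf σe = fixes-[] f fixes-↦
  where
  fixes-↦ : ∀ {z} → z ∈ vars f → Fixes σ (⟦ x ↦ e ⟧ z)
  fixes-↦ {z} z∈ with z ≟V x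
  ... | yes _ = σe
  ... | no _  = λ { (here refl) → σf z∈ }

↦-isSubst : ∀ {x e} → type e ≤T ty x → IsSubst ⟦ x ↦ e ⟧
↦-isSubst {x} te z with z ≟V x
... | yes refl = te
... | no _     = ≤T-refl

↦-absorbed : ∀ {x e θ} → θ x ≈AU e [ θ ] → ∀ f → (f [ ⟦ x ↦ e ⟧ ]) [ θ ] ≈AU f [ θ ]
↦-absorbed {x} {e} {θ} θx f =
  au-trans (≈AU-reflexive ([]-[] f ⟦ x ↦ e ⟧ θ)) ([]-cong f agree)
  where
  agree : ∀ z → ⟦ x ↦ e ⟧ z [ θ ] ≈AU θ z
  agree z with z ≟V x
  ... | yes refl = au-sym θx
  ... | no _     = au-refl

∘ₛ-apply : ∀ σ θ z → (σ ∘ₛ θ) z ≡ σ z [ θ ]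
∘ₛ-apply σ θ z with σ z ≟E var z
... | yes σz≡z = sym (cong (_[ θ ]) σz≡z)
... | no _     = refl

∘ₛ-isSubst : ∀ {σ θ} → IsSubst σ → IsSubst θ → IsSubst (σ ∘ₛ θ)
∘ₛ-isSubst {σ} {θ} σ-ok θ-ok z =
  subst (λ e → type e ≤T ty z) (sym (∘ₛ-apply σ θ z)) (≤T-trans (type-[] θ-ok (σ z)) (σ-ok z))

fixes-∘ₛ : ∀ {σ θ f} → Fixes σ f → Fixes θ f → Fixes (σ ∘ₛ θ) f
fixes-∘ₛ {σ} {θ} σf θf {w} w∈ = trans (∘ₛ-apply σ θ w) (trans (cong (_[ θ ]) (σf w∈)) (θf w∈))

-- Sound steps

IdempotentSubst : Subst → Set
IdempotentSubst σ = IsSubst σ × FixesRange σ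

Invariant : Problem → Set
Invariant ⟨ s ≐ t , σ ⟩ = IdempotentSubst σ × Fixes σ s × Fixes σ t
Invariant ⟨∅, σ ⟩       = IdempotentSubst σ
Invariant fail          = ⊥

Satisfies : Subst → Subst → Set
Satisfies θ σ = ∀ z → θ z ≈AU σ z [ θ ]

Solves : Subst → Problem → Set
Solves θ ⟨ s ≐ t , σ ⟩ = s [ θ ] ≈AU t [ θ ] × Satisfies θ σ
Solves θ ⟨∅, σ ⟩       = Satisfies θ σ
Solves θ fail          = ⊥

record SoundStep (P Q : Problem) : Set where
  field
    run : Invariant P → Invariant Q × (∀ θ → Solves θ Q → Solves θ P)
open SoundStep

infixr 4 _▹_
_▹_ : ∀ {P Q R} → SoundStep P Q → SoundStep Q R → SoundStep P R
(P→Q ▹ Q→R) .run inv =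
  let invQ , Q⇒P = P→Q .run inv
      invR , R⇒Q = Q→R .run invQ
  in invR , λ θ → Q⇒P θ ∘ R⇒Q θ

≈AU-step : ∀ {s t s′ t′ σ} → s ≈AU s′ → t ≈AU t′ → SoundStep ⟨ s ≐ t , σ ⟩ ⟨ s′ ≐ t′ , σ ⟩
≈AU-step s≈ t≈ .run (σ-ok , σs , σt) =
  (σ-ok , σs ∘ subst (_ ∈_) (sym (vars-≈AU s≈)) , σt ∘ subst (_ ∈_) (sym (vars-≈AU t≈))) ,
  λ θ (eq , sat) → au-trans ([]-resp-≈AU θ s≈) (au-trans eq (au-sym ([]-resp-≈AU θ t≈))) , sat

normalised : ∀ {s t s′ t′ σ τ} → SoundStep ⟨ s ≐ t , σ ⟩ ⟨ s′ ≐ t′ , τ ⟩ →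
             SoundStep ⟨ norm s ≐ norm t , σ ⟩ ⟨ norm s′ ≐ norm t′ , τ ⟩
normalised {s} {t} {s′} {t′} step =
  ≈AU-step (norm≈AU s) (norm≈AU t) ▹ step ▹ ≈AU-step (au-sym (norm≈AU s′)) (au-sym (norm≈AU t′))

swap : ∀ {s t σ} → SoundStep ⟨ s ≐ t , σ ⟩ ⟨ t ≐ s , σ ⟩
swap .run (σ-ok , σs , σt) = (σ-ok , σt , σs) , λ θ (eq , sat) → au-sym eq , sat

decompose : ∀ {σ} h L M → SoundStep ⟨ h ⸴ L ≐ h ⸴ M , σ ⟩ ⟨ L ≐ M , σ ⟩
decompose h L M .run (σ-ok , σs , σt) =
  (σ-ok , σs ∘ ∈-++⁺ʳ (vars h) , σt ∘ ∈-++⁺ʳ (vars h)) , λ θ (eq , sat) → au-cong au-refl eq , sat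

remove : ∀ {s σ} → SoundStep ⟨ s ≐ s , σ ⟩ ⟨∅, σ ⟩
remove .run (σ-ok , _) = σ-ok , λ θ sat → au-refl , sat

-- Fixes ⟦ x ↦ e ⟧ e says that x does not occur in e unless e is x itself.
instantiate : ∀ {s t σ} x e → σ x ≡ var x → Fixes σ e → Fixes ⟦ x ↦ e ⟧ e → type e ≤T ty x →
  SoundStep ⟨ s ≐ t , σ ⟩ ⟨ s [ ⟦ x ↦ e ⟧ ] ≐ t [ ⟦ x ↦ e ⟧ ] , σ ∘ₛ ⟦ x ↦ e ⟧ ⟩
instantiate {s} {t} {σ} x e σx σe ρe te .run ((σ-ok , σ-range) , σs , σt) =
  ((∘ₛ-isSubst {σ} {ρ} σ-ok (↦-isSubst {x} {e} te) , τ-range) , τ-fixes s σs , τ-fixes t σt) ,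
  reflect
  where
  ρ τ : Subst
  ρ = ⟦ x ↦ e ⟧
  τ = σ ∘ₛ ρ

  τ-fixes : ∀ f → Fixes σ f → Fixes τ (f [ ρ ])
  τ-fixes f σf =
    fixes-∘ₛ {f = f [ ρ ]} (fixes-[↦] {x = x} f σf σe) (fixes-[] f λ {z} _ → ↦-fixesRange {x} ρe z)

  τ-range : FixesRange τ
  τ-range z = subst (Fixes τ) (sym (∘ₛ-apply σ ρ z)) (τ-fixes (σ z) (σ-range z))

  τx≡e : τ x ≡ e
  τx≡e = trans (∘ₛ-apply σ ρ x) (trans (cong (_[ ρ ]) σx) (↦-self x e))

  reflect : ∀ θ → Solves θ ⟨ s [ ρ ] ≐ t [ ρ ] , τ ⟩ → Solves θ ⟨ s ≐ t , σ ⟩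
  reflect θ (eq , θτ) =
    au-trans (au-sym (absorbed s)) (au-trans eq (absorbed t)) ,
    λ z → au-trans (θτ z)
                   (subst (λ u → u [ θ ] ≈AU σ z [ θ ]) (sym (∘ₛ-apply σ ρ z)) (absorbed (σ z)))
    where
    absorbed : ∀ f → (f [ ρ ]) [ θ ] ≈AU f [ θ ]
    absorbed = ↦-absorbed (subst (λ u → θ x ≈AU u [ θ ]) τx≡e (θτ x))

assuming-invariant : ∀ {P Q} → (Invariant P → SoundStep P Q) → SoundStep P Q
assuming-invariant step .run inv = step inv .run inv

IsA-type : ∀ {a} → IsA a → type a ≤T atom
IsA-type (a-int _) = int≤atom
IsA-type (a-str _) = string≤atom
IsA-type (a-var (mkVar _ int)    _) = int≤atom
IsA-type (a-var (mkVar _ string) _) = string≤atom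
IsA-type (a-var (mkVar _ atom)   _) = ≤T-refl
IsA-type (a-var (mkVar _ list)   nl) = ⊥-elim (nl refl)

IsA⇒↦-fixes : ∀ {x a} → IsA a → Fixes ⟦ x ↦ a ⟧ a
IsA⇒↦-fixes {x} (a-var v _) (here refl) with v ≟V x
... | yes _ = refl
... | no _  = refl

bind-head : ∀ {σ} x L e M → Fixes ⟦ x ↦ e ⟧ e → type e ≤T ty x →
  SoundStep ⟨ var x ⸴ L ≐ e ⸴ M , σ ⟩ ⟨ L [ ⟦ x ↦ e ⟧ ] ≐ M [ ⟦ x ↦ e ⟧ ] , σ ∘ₛ ⟦ x ↦ e ⟧ ⟩
bind-head x L e M ρe te = assuming-invariant λ (_ , σs , σt) →
  instantiate x e (σs (here refl)) (σt ∘ ∈-++⁺ˡ) ρe te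
  ▹ ≈AU-step (≈AU-reflexive (cong (_⸴ L [ ρ ]) (↦-self x e)))
             (≈AU-reflexive (cong (_⸴ M [ ρ ]) ([]-identity e ρe)))
  ▹ decompose e (L [ ρ ]) (M [ ρ ])
  where
  ρ : Subst
  ρ = ⟦ x ↦ e ⟧

eliminate : ∀ {σ} x L e M → ty x ≡ list → x ∉ vars L → x ∉ vars (e ⸴ M) →
  SoundStep ⟨ var x ⸴ L ≐ e ⸴ M , σ ⟩ ⟨ L ≐ M , σ ∘ₛ ⟦ x ↦ e ⟧ ⟩
eliminate x L e M tx x∉L x∉t =
  bind-head x L e M (↦-fixes-∉ e (x∉t ∘ ∈-++⁺ˡ)) (≤T-list tx)
  ▹ ≈AU-step (≈AU-reflexive ([]-identity L (↦-fixes-∉ L x∉L)))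
             (≈AU-reflexive ([]-identity M (↦-fixes-∉ M (x∉t ∘ ∈-++⁺ʳ (vars e)))))

split : ∀ {σ} x L h M x′ → ty x ≡ list → x ∉ vars L → x ∉ vars (h ⸴ M) → x′ ≢ x → σ x′ ≡ var x′ →
  SoundStep ⟨ var x ⸴ L ≐ h ⸴ M , σ ⟩ ⟨ var x′ ⸴ L ≐ M , σ ∘ₛ ⟦ x ↦ h ⸴ var x′ ⟧ ⟩
split {σ} x L h M x′ tx x∉L x∉t x′≢x σx′ = assuming-invariant λ (_ , σs , σt) →
  instantiate x e (σs (here refl)) (σe (σt ∘ ∈-++⁺ˡ)) (↦-fixes-∉ e x∉e) (≤T-list tx)
  ▹ ≈AU-step (au-trans (≈AU-reflexive (cong₂ _⸴_ (↦-self x e) ([]-identity L (↦-fixes-∉ L x∉L))))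
                        (au-sym (au-assoc h (var x′) L)))
              (≈AU-reflexive ([]-identity (h ⸴ M) (↦-fixes-∉ (h ⸴ M) x∉t)))
  ▹ decompose h (var x′ ⸴ L) M
  where
  e : Expr
  e = h ⸴ var x′

  σe : Fixes σ h → Fixes σ e
  σe σh = [ σh , (λ { (here refl) → σx′ }) ]′ ∘ ∈-++⁻ (vars h)

  x∉e : x ∉ vars e
  x∉e = [ x∉t ∘ ∈-++⁺ˡ , (λ { (here x≡x′) → x′≢x (sym x≡x′) }) ]′ ∘ ∈-++⁻ (vars h)

bind-atom : ∀ {σ} x a y → IsA a → ty x ≡ atom → ty y ≡ list →
  SoundStep ⟨ var x ≐ a ⸴ var y , σ ⟩ ⟨ empty ≐ var y , σ ∘ₛ ⟦ x ↦ a ⟧ ⟩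
bind-atom x a y isA tx ty = assuming-invariant λ (_ , σs , σt) →
  instantiate x a (σs (here refl)) (σt ∘ ∈-++⁺ˡ) ρa (subst (type a ≤T_) (sym tx) (IsA-type isA))
  ▹ ≈AU-step (au-trans (≈AU-reflexive (↦-self x a)) (au-sym (au-unitʳ a)))
             (≈AU-reflexive (cong₂ _⸴_ ([]-identity a ρa) (↦-other a y≢x)))
  ▹ decompose a empty (var y)
  where
  ρa : Fixes ⟦ x ↦ a ⟧ a
  ρa = IsA⇒↦-fixes isA

  y≢x : y ≢ x
  y≢x refl with trans (sym ty) tx
  ... | ()

assign : ∀ {σ} x L → x ∉ vars L → type L ≤T ty x →
  SoundStep ⟨ var x ≐ L , σ ⟩ ⟨∅, σ ∘ₛ ⟦ x ↦ L ⟧ ⟩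
assign x L x∉L tL = assuming-invariant λ (_ , σs , σt) →
  instantiate x L (σs (here refl)) σt ρL tL
  ▹ ≈AU-step (≈AU-reflexive (↦-self x L)) (≈AU-reflexive ([]-identity L ρL))
  ▹ remove
  where
  ρL : Fixes ⟦ x ↦ L ⟧ L
  ρL = ↦-fixes-∉ L x∉L

-- Simplicity and disjointness of list variables

listVarOcc-list : ∀ x → ty x ≡ list → listVarOcc (var x) ≡ 1
listVarOcc-list (mkVar _ _) refl = refl

listVarOcc-nonlist : ∀ x → ty x ≢ list → listVarOcc (var x) ≡ 0
listVarOcc-nonlist (mkVar _ int)    _  = refl
listVarOcc-nonlist (mkVar _ string) _  = refl
listVarOcc-nonlist (mkVar _ atom)   _  = refl
listVarOcc-nonlist (mkVar _ list)   nl = ⊥-elim (nl refl)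

listVarOcc-∈ : ∀ {w} f → ty w ≡ list → w ∈ vars f → 1 ≤ listVarOcc f
listVarOcc-∈ (var w) tw (here refl) = ≤-reflexive (sym (listVarOcc-list w tw))
listVarOcc-∈ (a ⸴ b) tw w∈ with ∈-++⁻ (vars a) w∈
... | inj₁ w∈a = ≤-trans (listVarOcc-∈ a tw w∈a) (m≤m+n _ _)
... | inj₂ w∈b = ≤-trans (listVarOcc-∈ b tw w∈b) (m≤n+m _ (listVarOcc a))

infix 4 _≼_
record _≼_ (f e : Expr) : Set where
  constructor ≼-intro
  field
    listVarOcc-≤  : listVarOcc f ≤ listVarOcc e
    listVars-⊆    : ∀ {w} → ty w ≡ list → w ∈ vars f → w ∈ vars e

≼-refl : ∀ {e} → e ≼ e
≼-refl = ≼-intro (≤-reflexive refl) λ _ w∈ → w∈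

≼-trans : ∀ {e f g} → e ≼ f → f ≼ g → e ≼ g
≼-trans (≼-intro o₁ v₁) (≼-intro o₂ v₂) = ≼-intro (≤-trans o₁ o₂) λ tw → v₂ tw ∘ v₁ tw

≈AU⇒≼ : ∀ {e f} → e ≈AU f → e ≼ f
≈AU⇒≼ e≈f = ≼-intro (≤-reflexive (listVarOcc-≈AU e≈f)) λ _ → subst (_ ∈_) (vars-≈AU e≈f)

norm-mono-≼ : ∀ e f → e ≼ f → norm e ≼ norm f
norm-mono-≼ e f e≼f = ≼-trans (≈AU⇒≼ (norm≈AU e)) (≼-trans e≼f (≈AU⇒≼ (au-sym (norm≈AU f))))

≼-⸴ʳ : ∀ {a b} → b ≼ a ⸴ b
≼-⸴ʳ {a} = ≼-intro (m≤n+m _ (listVarOcc a)) λ _ → ∈-++⁺ʳ (vars a)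

norm-⸴-≼ : ∀ a b → norm b ≼ norm (a ⸴ b)
norm-⸴-≼ a b = norm-mono-≼ b (a ⸴ b) ≼-⸴ʳ

⸴-mono-≼ : ∀ {a b c d} → a ≼ c → b ≼ d → a ⸴ b ≼ c ⸴ d
⸴-mono-≼ {a} {c = c} (≼-intro oa va) (≼-intro ob vb) =
  ≼-intro (+-mono-≤ oa ob) λ tw → [ ∈-++⁺ˡ ∘ va tw , ∈-++⁺ʳ (vars c) ∘ vb tw ]′ ∘ ∈-++⁻ (vars a)

empty-≼ : ∀ {e} → empty ≼ e
empty-≼ = ≼-intro z≤n λ _ ()

[]-≼ : ∀ {θ} f → (∀ z → θ z ≼ var z) → f [ θ ] ≼ f
[]-≼ (icon _) θ≼ = ≼-refl
[]-≼ (scon _) θ≼ = ≼-refl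
[]-≼ empty    θ≼ = ≼-refl
[]-≼ (var x)  θ≼ = θ≼ x
[]-≼ (a ⸴ b)  θ≼ = ⸴-mono-≼ ([]-≼ a θ≼) ([]-≼ b θ≼)

IsA⇒≼empty : ∀ {a} → IsA a → a ≼ empty
IsA⇒≼empty (a-int _)    = ≼-intro z≤n λ _ ()
IsA⇒≼empty (a-str _)    = ≼-intro z≤n λ _ ()
IsA⇒≼empty (a-var v nl) =
  ≼-intro (≤-reflexive (listVarOcc-nonlist v nl)) λ { tw (here refl) → ⊥-elim (nl tw) }

↦-≼ : ∀ {x a} → a ≼ empty → ∀ z → ⟦ x ↦ a ⟧ z ≼ var z
↦-≼ {x} a≼ z with z ≟V x
... | yes _ = ≼-trans a≼ empty-≼
... | no _  = ≼-refl

-- The paper's "no common variables" is weakened to list variables, since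
-- Decomp1' may leave an atom variable on both sides.
record Linear (s t : Expr) : Set where
  constructor linear
  field
    simple-s : Simple s
    simple-t : Simple t
    disjoint : ∀ {w} → ty w ≡ list → w ∈ vars s → w ∈ vars t → ⊥

linear-≼ : ∀ {s t s′ t′} → s′ ≼ s → t′ ≼ t → Linear s t → Linear s′ t′
linear-≼ (≼-intro os vs) (≼-intro ot vt) (linear simple-s simple-t disjoint) =
  linear (≤-trans os simple-s) (≤-trans ot simple-t)
         λ tw w∈s w∈t → disjoint tw (vs tw w∈s) (vt tw w∈t)

linear-denorm : ∀ {s t} → Linear (norm s) (norm t) → Linear s t
linear-denorm {s} {t} = linear-≼ (≈AU⇒≼ (au-sym (norm≈AU s))) (≈AU⇒≼ (au-sym (norm≈AU t)))

linear-swap : ∀ {s t} → Linear s t → Linear t s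
linear-swap (linear simple-s simple-t disjoint) =
  linear simple-t simple-s λ tw w∈t w∈s → disjoint tw w∈s w∈t

linear-head : ∀ x L t → ty x ≡ list → Linear (var x ⸴ L) t → x ∉ vars L × x ∉ vars t
linear-head x L t tx (linear simple-s _ disjoint) = x∉L , disjoint tx (here refl)
  where
  x∉L : x ∉ vars L
  x∉L x∈L
    with ≤-trans (+-mono-≤ (≤-reflexive (sym (listVarOcc-list x tx))) (listVarOcc-∈ L tx x∈L)) simple-s
  ... | s≤s ()

linear-rename-head : ∀ {x x′ L t} → ty x ≡ list → ty x′ ≡ list → x′ ∉ vars t →
                     Linear (var x ⸴ L) t → Linear (var x′ ⸴ L) t
linear-rename-head {x} {x′} {L} tx tx′ x′∉t (linear simple-s simple-t disjoint) =
  linear (subst (λ n → n + listVarOcc L ≤ 1) same-occurrences simple-s) simple-t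
         λ { _ (here refl) → x′∉t ; tw (there w∈L) → disjoint tw (there w∈L) }
  where
  same-occurrences : listVarOcc (var x) ≡ listVarOcc (var x′)
  same-occurrences = trans (listVarOcc-list x tx) (sym (listVarOcc-list x′ tx′))

split-linear : ∀ x x′ L h M → ty x ≡ list → ty x′ ≡ list → x′ ∉ vars (h ⸴ M) →
               Linear (norm (var x ⸴ L)) (norm (h ⸴ M)) → Linear (norm (var x′ ⸴ L)) (norm M)
split-linear x x′ L h M tx tx′ x′∉t =
  linear-≼ (≈AU⇒≼ (norm≈AU (var x′ ⸴ L))) (≼-trans (≈AU⇒≼ (norm≈AU M)) (≼-⸴ʳ {h}))
  ∘ linear-rename-head tx tx′ x′∉t ∘ linear-denorm

-- Soundness of the transformation relation

LinearProblem : Problem → Set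
LinearProblem ⟨ s ≐ t , _ ⟩ = Linear s t
LinearProblem _             = ⊤

⇒-linear : ∀ {P Q} → P ⇒ Q → LinearProblem P → LinearProblem Q
⇒-linear (Remove _ _ _ _) _ = tt
⇒-linear (Decomp1 x L e M _ _ _ refl refl _ _) = linear-≼ (norm-⸴-≼ (var x) L) (norm-⸴-≼ e M)
⇒-linear (Decomp1' x L a M _ _ isA refl refl _ _ _) =
  linear-≼ (norm-mono-≼ (L [ ρ ]) (var x ⸴ L) (≼-trans ([]-≼ L x↦a≼) ≼-⸴ʳ))
           (norm-mono-≼ (M [ ρ ]) (a ⸴ M) (≼-trans ([]-≼ M x↦a≼) ≼-⸴ʳ))
  where
  ρ : Subst
  ρ = ⟦ x ↦ a ⟧

  x↦a≼ : ∀ z → ρ z ≼ var z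
  x↦a≼ = ↦-≼ (IsA⇒≼empty isA)
⇒-linear (Decomp2 x L y M x′ _ _ refl refl _ tx _ (tx′ , _ , x′∉t , _)) =
  split-linear x x′ L (var y) M tx tx′ (∉-norm (var y ⸴ M) x′∉t)
⇒-linear (Decomp2' x L y M y′ _ _ refl refl _ _ ty (ty′ , y′∉s , _)) =
  linear-swap ∘ split-linear y y′ M (var x) L ty ty′ (∉-norm (var x ⸴ L) y′∉s) ∘ linear-swap
⇒-linear (Decomp3 e L M _ _ _ refl refl) = linear-≼ (norm-⸴-≼ e L) (norm-⸴-≼ e M)
⇒-linear (Decomp4 x a y _ refl refl _ _) = linear-≼ empty-≼ (norm-⸴-≼ a (var y))
⇒-linear (Subst1 _ _ _ _ _ _ _) _ = tt
⇒-linear (Subst2 x L M _ _ refl refl _ _) = linear-≼ (norm-⸴-≼ (var x) L) ≼-refl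
⇒-linear (Subst3 x L a M x′ _ _ _ refl refl _ tx (tx′ , _ , x′∉t , _)) =
  split-linear x x′ L a M tx tx′ (∉-norm (a ⸴ M) x′∉t)
⇒-linear (Orient1 _ _ _ _ _ _ _ _ refl refl) = linear-swap
⇒-linear (Orient2 _ _ _ _ refl refl _ _) = linear-swap
⇒-linear (Orient3 _ _ _ _ _ _ refl refl _) = linear-swap
⇒-linear (Orient4 _ _ _ refl refl _) = linear-swap

eliminate-normalised : ∀ {σ} x L e M → ty x ≡ list → Linear (norm (var x ⸴ L)) (norm (e ⸴ M)) →
  SoundStep ⟨ norm (var x ⸴ L) ≐ norm (e ⸴ M) , σ ⟩ ⟨ norm L ≐ norm M , σ ∘ₛ ⟦ x ↦ e ⟧ ⟩
eliminate-normalised x L e M tx lin =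
  normalised (uncurry (eliminate x L e M tx) (linear-head x L (e ⸴ M) tx (linear-denorm lin)))

split-normalised : ∀ {σ} x L h M x′ → ty x ≡ list → x′ ∉ vars (norm (var x ⸴ L)) → ¬ (x′ ∈Dom σ) →
  Linear (norm (var x ⸴ L)) (norm (h ⸴ M)) →
  SoundStep ⟨ norm (var x ⸴ L) ≐ norm (h ⸴ M) , σ ⟩
            ⟨ norm (var x′ ⸴ L) ≐ norm M , σ ∘ₛ ⟦ x ↦ h ⸴ var x′ ⟧ ⟩
split-normalised {σ} x L h M x′ tx x′∉s x′∉Dom lin =
  normalised (uncurry (split x L h M x′ tx) (linear-head x L (h ⸴ M) tx (linear-denorm lin))
                      (∉-norm (var x ⸴ L) x′∉s ∘ here) (∉Dom⇒fixed σ x′ x′∉Dom))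

⇒-sound : ∀ {P Q} → P ⇒ Q → LinearProblem P → SoundStep P Q
⇒-sound (Remove _ _ refl refl) _ = remove
⇒-sound (Decomp1 x L e M _ _ _ refl refl _ tx) = eliminate-normalised x L e M tx
⇒-sound (Decomp1' x L a M _ _ isA refl refl _ ta _) _ =
  normalised (bind-head x L a M (IsA⇒↦-fixes isA) ta)
⇒-sound (Decomp2 x L y M x′ _ _ refl refl _ tx _ (_ , x′∉s , _ , x′∉Dom , _)) =
  split-normalised x L (var y) M x′ tx x′∉s x′∉Dom
⇒-sound (Decomp2' x L y M y′ _ _ refl refl _ _ ty (_ , _ , y′∉t , y′∉Dom , _)) lin =
  swap ▹ split-normalised y M (var x) L y′ ty y′∉t y′∉Dom (linear-swap lin) ▹ swap
⇒-sound (Decomp3 e L M _ _ _ refl refl) _ = normalised (decompose e L M)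
⇒-sound (Decomp4 x a y isA refl refl tx ty) _ = normalised (bind-atom x a y isA tx ty)
⇒-sound (Subst1 x L _ refl refl x∉L tL) _ = ≈AU-step au-refl (norm≈AU L) ▹ assign x L x∉L tL
⇒-sound (Subst2 x L M _ _ refl refl _ tx) = eliminate-normalised x L empty M tx
⇒-sound (Subst3 x L a M x′ _ _ _ refl refl _ tx (_ , x′∉s , _ , x′∉Dom , _)) =
  split-normalised x L a M x′ tx x′∉s x′∉Dom
⇒-sound (Orient1 _ _ _ _ _ _ _ _ refl refl) _ = swap
⇒-sound (Orient2 _ _ _ _ refl refl _ _) _ = swap
⇒-sound (Orient3 _ _ _ _ _ _ refl refl _) _ = swap
⇒-sound (Orient4 _ _ _ refl refl _) _ = swap

⇒⁺-sound : ∀ {P Q} → P ⇒⁺ Q → LinearProblem P → SoundStep P Q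
⇒⁺-sound [ step ]⁺      lin = ⇒-sound step lin
⇒⁺-sound (step ∷ steps) lin = ⇒-sound step lin ▹ ⇒⁺-sound steps (⇒-linear step lin)

invariant : ∀ P → IsUnifProblem P → DomAvoidsEquation P → Idempotent (substOf P) → Invariant P
invariant ⟨ s ≐ t , σ ⟩ (_ , _ , _ , σ-ok) (s∉Dom , t∉Dom) idem =
  (σ-ok , idempotent⇒fixesRange idem) ,
  (λ w∈ → ∉Dom⇒fixed σ _ (s∉Dom _ w∈)) , (λ w∈ → ∉Dom⇒fixed σ _ (t∉Dom _ w∈))
invariant ⟨∅, σ ⟩ σ-ok _ idem = σ-ok , idempotent⇒fixesRange idem

linearProblem : ∀ P → IsUnifProblem P → LinearProblem P
linearProblem ⟨ s ≐ t , _ ⟩ (simple-s , simple-t , no-common , _) =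
  linear simple-s simple-t λ {w} _ → no-common w
linearProblem ⟨∅, _ ⟩ _ = tt

satisfies-self : ∀ {σ} → FixesRange σ → Satisfies σ σ
satisfies-self {σ} range z = ≈AU-reflexive (sym ([]-identity (σ z) (range z)))

solves⇒isUnifier : ∀ {θ} P → IsSubst θ → Solves θ P → IsUnifier θ P
solves⇒isUnifier ⟨ _ ≐ _ , _ ⟩ θ-ok (eq , sat) = θ-ok , eq , λ z _ → sat z
solves⇒isUnifier ⟨∅, _ ⟩       θ-ok sat        = θ-ok , λ z _ → sat z

theorem2 : (P : Problem) (σ' : Subst) →
    IsUnifProblem P → DomAvoidsEquation P → Idempotent (substOf P) →
    P ⇒⁺ ⟨∅, σ' ⟩ →
    IsUnifier σ' P
theorem2 P σ' problem avoids idempotent steps =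
  let (σ'-ok , σ'-range) , reflect =
        ⇒⁺-sound steps (linearProblem P problem) .run (invariant P problem avoids idempotent)
  in solves⇒isUnifier P σ'-ok (reflect σ' (satisfies-self σ'-range))
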